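{- For all integers $n,d\ge1$, the Bredon cohomology group satisfies $H^d_{\mathbb Z_2}(T^n;\pi_2(S^2))\cong \mathbb Z_2^{\binom{n-1}{d-1}}$.
   Context: $T^n=(S^1)^n\subseteq\mathbb C^n$ carries the free $\mathbb Z_2$-action $(z_1,\dots,z_n)\mapsto(-z_1,\dots,-z_n)$ and a $\mathbb Z_2$-CW structure compatible with it. $\pi_2(S^2)\cong\mathbb Z$ is regarded as a module over the group ring $\mathbb Z[\mathbb Z_2]=\mathbb Z[\nu]/(\nu^2-1)$ via the action induced by the antipodal map of $S^2$ (so $\nu$ acts by $-1$). For a $\mathbb Z_2$-CW complex $X$, the cellular chain groups $C_d(X)$ are $\mathbb Z[\mathbb Z_2]$-modules with $(n_0+n_1\nu)\sigma=n_0\sigma+n_1(\nu\cdot\sigma)$; for a $\mathbb Z[\mathbb Z_2]$-module $N$, the equivariant cochain complex is $C^d_{\mathbb Z_2}(X;N)=\mathrm{Hom}_{\mathbb Z[\mathbb Z_2]}(C_d(X),N)$ with the usual coboundary, and its cohomology is the Bredon cohomology $H^\bullet_{\mathbb Z_2}(X;N)$. -}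

module Defs where

open import Data.Nat using (ℕ; zero; suc)
open import Data.Integer using (ℤ; +_; -_; _+_; _-_)
open import Data.Bool using (Bool; true; false; not; if_then_else_; _xor_)
open import Data.Product using (Σ; _×_; _,_; ∃)
open import Data.Vec using (Vec; []; _∷_; map; zipWith; replicate)
open import Relation.Binary.PropositionalEquality using (_≡_; _≢_)
open import Function.Bundles using (_⇔_)

-- Cellular Z2-CW structure on S¹ ⊆ ℂ with the antipodal action:
--   0-cells  a₀ = {1},  b₀ = {-1} = ν·a₀
--   1-cells  a₁ = upper arc from 1 to -1,  b₁ = lower arc from -1 to 1 = ν·a₁
--   ∂a₁ = b₀ - a₀ ,  ∂b₁ = a₀ - b₀.
-- A cell of S¹ is encoded as (isOneCell , sign) : Bool × Bool, where sign = true
-- means the a-cell and false the b-cell; ν flips the sign.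
-- In both cases ∂(1-cell with sign s) = (0-cell with sign (not s)) - (0-cell with sign s).
S1Cell : Set
S1Cell = Bool × Bool

-- T^n = (S¹)^n with the product cell structure; ν acts diagonally by flipping
-- every sign (this is the free Z2-action z ↦ -z).  A cell of T^n is a vector of
-- n cells of S¹ (the product cell).
Cell : ℕ → Set
Cell n = Vec S1Cell n

flipCell : S1Cell → S1Cell
flipCell (e , s) = (e , not s)

ν· : ∀ {n} → Cell n → Cell n
ν· = map flipCell

dim : ∀ {n} → Cell n → ℕ
dim [] = zero
dim ((true , _) ∷ σ) = suc (dim σ)
dim ((false , _) ∷ σ) = dim σ

-- An integer-valued function on all cells; a d-cochain will be one supported on
-- d-cells (Hom from the free abelian group on the d-cells, extended by 0).
Fn : ℕ → Set
Fn n = Cell n → ℤ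

_+ᶠ_ : ∀ {n} → Fn n → Fn n → Fn n
(f +ᶠ g) σ = f σ + g σ

-- Coboundary (δf)(σ) = f(∂σ), with the Koszul sign rule for the product cells:
--   ∂(x ⊗ τ) = ∂x ⊗ τ + (-1)^{|x|} x ⊗ ∂τ.
δ : ∀ {n} → Fn n → Fn n
δ {zero} f [] = + 0
δ {suc n} f ((true , s) ∷ τ) =
  (f ((false , not s) ∷ τ) - f ((false , s) ∷ τ)) - δ (λ ρ → f ((true , s) ∷ ρ)) τ
δ {suc n} f ((false , s) ∷ τ) = δ (λ ρ → f ((false , s) ∷ ρ)) τ

-- Equivariant d-cochains with coefficients in π₂(S²) ≅ ℤ where ν acts by -1:
-- elements of Hom_{ℤ[Z2]}(C_d(T^n), ℤ_-), i.e. functions on d-cells with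
-- f(ν·σ) = - f(σ).
IsCochain : ∀ {n} → ℕ → Fn n → Set
IsCochain d f = (∀ σ → dim σ ≢ d → f σ ≡ + 0) × (∀ σ → f (ν· σ) ≡ - f σ)

IsCocycle : ∀ {n} → ℕ → Fn n → Set
IsCocycle d f = IsCochain d f × (∀ σ → δ f σ ≡ + 0)

IsCoboundary : ∀ {n} → ℕ → Fn n → Set
IsCoboundary zero f = ∀ σ → f σ ≡ + 0
IsCoboundary (suc k) f = ∃ λ g → IsCochain k g × (∀ σ → δ g σ ≡ f σ)

Z2^ : ℕ → Set
Z2^ k = Vec Bool k

-- H^d_{Z2}(T^n; π₂(S²)) ≅ (Z2)^k, expressed via the first isomorphism theorem:
-- a map φ on cocycles, respecting pointwise equality, additive, surjective, whose
-- kernel is exactly the coboundaries.  Then Z^d / B^d ≅ (Z2)^k.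
BredonIso : ℕ → ℕ → ℕ → Set
BredonIso n d k =
  Σ (Fn n → Z2^ k) λ φ →
    (∀ f g → IsCocycle d f → IsCocycle d g → (∀ σ → f σ ≡ g σ) → φ f ≡ φ g)
  × (∀ f g → IsCocycle d f → IsCocycle d g → φ (f +ᶠ g) ≡ zipWith _xor_ (φ f) (φ g))
  × (∀ v → ∃ λ f → IsCocycle d f × φ f ≡ v)
  × (∀ f → IsCocycle d f → (φ f ≡ replicate _ false ⇔ IsCoboundary d f))

{-# OPTIONS --safe #-}

-- An antiequivariant cochain on T^(m+1) = S¹ × T^m is determined by its values A on a₀ × T^m and
-- B on a₁ × T^m, and in these coordinates the coboundary is (A , B) ↦ (δ A , − (1 + ν) A − δ B):
-- the Bredon complex is the mapping cone of −(1 + ν) on the cellular cochains of T^m.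
-- The cohomology of T^m is free on the coordinate subtori T^S, and this is realised on cochains by
-- an evaluation map ev, representatives rep and a chain homotopy htpy between id and rep ∘ ev.
-- Since ν is a rotation it acts trivially on cohomology, so 1 + ν is multiplication by 2 there.
-- Consequently, for a cone cocycle (A , B) the class of A vanishes, A = δ (htpy A), and the class of
-- B + (1 + ν) (htpy A) in H^(d−1)(T^m) is well defined modulo twice the classes: reducing it mod 2
-- and listing its values on the (d−1)-element subsets is the isomorphism onto Z₂^C(n−1, d−1).

module Submission where

open import Defs
open import Data.Nat using (ℕ; _≤_; _∸_)
open import Data.Nat.Combinatorics using (_C_)

open import Algebra.Bundles using (AbelianGroup)
open import Data.Bool using (Bool; true; false; not; _xor_)
open import Data.Bool.Properties
  using (not-involutive; not-distribˡ-xor; xor-annihilates-not; xor-comm; xor-identityʳ; xor-same)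
open import Data.Empty using (⊥-elim)
open import Data.Fin.Subset using (Subset; ∣_∣)
open import Data.Integer using (ℤ; +_; -[1+_]; -_; _+_; _-_; _⊖_)
open import Data.Integer.Properties
  using ( +-comm; +-identityˡ; +-identityʳ; +-inverseˡ; +-inverseʳ; +-0-abelianGroup
        ; neg-distrib-+; neg-involutive; [1+m]⊖[1+n]≡m⊖n; ⊖-≥; ⊖-≤)
open import Data.Integer.Tactic.RingSolver using (solve-∀)
import Data.Nat as ℕ
open import Data.Nat using (zero; suc)
open import Data.Nat.Combinatorics using (nCk+nC[k+1]≡[n+1]C[k+1])
open import Data.Nat.Properties using (suc-injective)
open import Data.Product using (∃-syntax; _×_; _,_; proj₁; proj₂)
open import Data.Unit using (⊤; tt)
open import Data.Vec using (Vec; []; _∷_; _++_; head; zipWith; replicate; take; drop)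
open import Data.Vec.Properties using (zipWith-++; take++drop≡id; ++-injectiveˡ; ++-injectiveʳ)
open import Function using (_∘_; const)
open import Function.Bundles using (mk⇔)
open import Relation.Binary.PropositionalEquality
open import Relation.Nullary using (yes; no)

open import Algebra.Properties.Group (AbelianGroup.group +-0-abelianGroup)
  using (identityˡ-unique; inverseˡ-unique)

-- Parity of integers

parityℕ : ℕ → Bool
parityℕ zero = false
parityℕ (suc n) = not (parityℕ n)

parity : ℤ → Bool
parity (+ n) = parityℕ n
parity -[1+ n ] = parityℕ (suc n)

bit : Bool → ℤ
bit false = + 0
bit true = + 1

parityℕ-+ : ∀ m n → parityℕ (m ℕ.+ n) ≡ parityℕ m xor parityℕ n
parityℕ-+ zero n = refl
parityℕ-+ (suc m) n = trans (cong not (parityℕ-+ m n)) (not-distribˡ-xor (parityℕ m) (parityℕ n))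

parity-⊖ : ∀ m n → parity (m ⊖ n) ≡ parityℕ m xor parityℕ n
parity-⊖ m zero = trans (cong parity (⊖-≥ {m} ℕ.z≤n)) (sym (xor-identityʳ (parityℕ m)))
parity-⊖ zero (suc n) = cong parity (⊖-≤ {n = suc n} ℕ.z≤n)
parity-⊖ (suc m) (suc n) = begin
  parity (suc m ⊖ suc n)              ≡⟨ cong parity ([1+m]⊖[1+n]≡m⊖n m n) ⟩
  parity (m ⊖ n)                      ≡⟨ parity-⊖ m n ⟩
  parityℕ m xor parityℕ n             ≡⟨ xor-annihilates-not (parityℕ m) (parityℕ n) ⟨
  parityℕ (suc m) xor parityℕ (suc n) ∎
  where open ≡-Reasoning

parity-+ : ∀ x y → parity (x + y) ≡ parity x xor parity y
parity-+ (+ m) (+ n) = parityℕ-+ m n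
parity-+ (+ m) -[1+ n ] = parity-⊖ m (suc n)
parity-+ -[1+ m ] (+ n) = trans (parity-⊖ n (suc m)) (xor-comm (parityℕ n) (parityℕ (suc m)))
parity-+ -[1+ m ] -[1+ n ] = begin
  not (not (parityℕ (m ℕ.+ n)))      ≡⟨ not-involutive _ ⟩
  parityℕ (m ℕ.+ n)                   ≡⟨ parityℕ-+ m n ⟩
  parityℕ m xor parityℕ n             ≡⟨ xor-annihilates-not (parityℕ m) (parityℕ n) ⟨
  parityℕ (suc m) xor parityℕ (suc n) ∎
  where open ≡-Reasoning

parity-neg : ∀ x → parity (- x) ≡ parity x
parity-neg (+ zero) = refl
parity-neg (+ suc n) = refl
parity-neg -[1+ n ] = refl

parity-double : ∀ x → parity (x + x) ≡ false
parity-double x = trans (parity-+ x x) (xor-same (parity x))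

parity-bit : ∀ b → parity (bit b) ≡ b
parity-bit false = refl
parity-bit true = refl

bit+bit-not : ∀ b → bit b + bit (not b) ≡ + 1
bit+bit-not false = refl
bit+bit-not true = refl

parity-decomposition : ∀ x → ∃[ q ] x ≡ (q + q) + bit (parity x)
parity-decomposition (+ n) = natural n
  where
  natural : ∀ n → ∃[ q ] + n ≡ (q + q) + bit (parityℕ n)
  natural zero = + 0 , refl
  natural (suc n) with natural n
  ... | q , eq = q + b , (begin
    + suc n                       ≡⟨ +-comm (+ 1) (+ n) ⟩
    + n + + 1                     ≡⟨ cong (λ z → z + + 1) eq ⟩
    ((q + q) + b) + + 1           ≡⟨ cong (λ z → ((q + q) + b) + z) (bit+bit-not (parityℕ n)) ⟨
    ((q + q) + b) + (b + b′)      ≡⟨ regroup q b b′ ⟩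
    ((q + b) + (q + b)) + b′      ∎)
    where
    open ≡-Reasoning
    b = bit (parityℕ n)
    b′ = bit (not (parityℕ n))
    regroup : ∀ q b c → ((q + q) + b) + (b + c) ≡ ((q + b) + (q + b)) + c
    regroup = solve-∀
parity-decomposition -[1+ n ] with parity-decomposition (+ suc n)
... | q , eq = - q - b , trans (cong -_ eq) (negate q b)
  where
  b = bit (parityℕ (suc n))
  negate : ∀ q b → - ((q + q) + b) ≡ ((- q - b) + (- q - b)) + b
  negate = solve-∀

-- Subsets of a given size

-- Pascal's recursion, which makes values below structurally recursive.
choose : ℕ → ℕ → ℕ
choose zero zero = 1
choose zero (suc k) = 0
choose (suc m) zero = choose m zero
choose (suc m) (suc k) = choose m k ℕ.+ choose m (suc k)

choose≡C : ∀ m k → choose m k ≡ m C k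
choose≡C zero zero = refl
choose≡C zero (suc k) = refl
choose≡C (suc zero) zero = refl
choose≡C (suc (suc m)) zero = choose≡C (suc m) zero
choose≡C (suc m) (suc k) =
  trans (cong₂ ℕ._+_ (choose≡C m k) (choose≡C m (suc k))) (nCk+nC[k+1]≡[n+1]C[k+1] m k)

values : ∀ m k → (Subset m → Bool) → Vec Bool (choose m k)
values zero zero c = c [] ∷ []
values zero (suc k) c = []
values (suc m) zero c = values m zero (c ∘ (false ∷_))
values (suc m) (suc k) c = values m k (c ∘ (true ∷_)) ++ values m (suc k) (c ∘ (false ∷_))

fromValues : ∀ m k → Vec Bool (choose m k) → Subset m → Bool
fromValues zero zero (b ∷ []) [] = b
fromValues zero (suc k) v [] = false
fromValues (suc m) zero v (true ∷ S) = false
fromValues (suc m) zero v (false ∷ S) = fromValues m zero v S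
fromValues (suc m) (suc k) v (true ∷ S) = fromValues m k (take (choose m k) v) S
fromValues (suc m) (suc k) v (false ∷ S) = fromValues m (suc k) (drop (choose m k) v) S

values-cong : ∀ m k {c d : Subset m → Bool} → c ≗ d → values m k c ≡ values m k d
values-cong zero zero c≗d = cong (_∷ []) (c≗d [])
values-cong zero (suc k) c≗d = refl
values-cong (suc m) zero c≗d = values-cong m zero (c≗d ∘ (false ∷_))
values-cong (suc m) (suc k) c≗d =
  cong₂ _++_ (values-cong m k (c≗d ∘ (true ∷_))) (values-cong m (suc k) (c≗d ∘ (false ∷_)))

values-xor : ∀ m k (c d : Subset m → Bool) →
  values m k (λ S → c S xor d S) ≡ zipWith _xor_ (values m k c) (values m k d)
values-xor zero zero c d = refl
values-xor zero (suc k) c d = refl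
values-xor (suc m) zero c d = values-xor m zero (c ∘ (false ∷_)) (d ∘ (false ∷_))
values-xor (suc m) (suc k) c d = trans
  (cong₂ _++_ (values-xor m k (c ∘ (true ∷_)) (d ∘ (true ∷_)))
              (values-xor m (suc k) (c ∘ (false ∷_)) (d ∘ (false ∷_))))
  (sym (zipWith-++ _xor_ (values m k (c ∘ (true ∷_))) (values m (suc k) (c ∘ (false ∷_)))
                         (values m k (d ∘ (true ∷_))) (values m (suc k) (d ∘ (false ∷_)))))

replicate-++ : ∀ {A : Set} p q (x : A) → replicate (p ℕ.+ q) x ≡ replicate p x ++ replicate q x
replicate-++ zero q x = refl
replicate-++ (suc p) q x = cong (x ∷_) (replicate-++ p q x)

values-false : ∀ m k → values m k (const false) ≡ replicate (choose m k) false
values-false zero zero = refl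
values-false zero (suc k) = refl
values-false (suc m) zero = values-false m zero
values-false (suc m) (suc k) =
  trans (cong₂ _++_ (values-false m k) (values-false m (suc k)))
        (sym (replicate-++ (choose m k) (choose m (suc k)) false))

++≡replicate : ∀ {A : Set} {p q} (xs : Vec A p) (ys : Vec A q) x →
  xs ++ ys ≡ replicate (p ℕ.+ q) x → xs ≡ replicate p x × ys ≡ replicate q x
++≡replicate {p = p} {q} xs ys x eq =
  ++-injectiveˡ xs (replicate p x) eq′ , ++-injectiveʳ xs (replicate p x) eq′
  where
  eq′ = trans eq (replicate-++ p q x)

values≡false⇒ : ∀ m k (c : Subset m → Bool) → values m k c ≡ replicate (choose m k) false →
  ∀ S → ∣ S ∣ ≡ k → c S ≡ false
values≡false⇒ zero zero c eq [] refl = cong head eq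
values≡false⇒ (suc m) zero c eq (false ∷ S) ∣S∣≡k = values≡false⇒ m zero (c ∘ (false ∷_)) eq S ∣S∣≡k
values≡false⇒ (suc m) (suc k) c eq (true ∷ S) ∣S∣≡k =
  values≡false⇒ m k (c ∘ (true ∷_)) (proj₁ (++≡replicate _ _ false eq)) S (suc-injective ∣S∣≡k)
values≡false⇒ (suc m) (suc k) c eq (false ∷ S) ∣S∣≡k =
  values≡false⇒ m (suc k) (c ∘ (false ∷_)) (proj₂ (++≡replicate _ _ false eq)) S ∣S∣≡k

values-fromValues : ∀ m k (v : Vec Bool (choose m k)) → values m k (fromValues m k v) ≡ v
values-fromValues zero zero (b ∷ []) = refl
values-fromValues zero (suc k) [] = refl
values-fromValues (suc m) zero v = values-fromValues m zero v
values-fromValues (suc m) (suc k) v =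
  trans (cong₂ _++_ (values-fromValues m k (take (choose m k) v))
                    (values-fromValues m (suc k) (drop (choose m k) v)))
        (take++drop≡id (choose m k) v)

fromValues-outside : ∀ m k (v : Vec Bool (choose m k)) S → ∣ S ∣ ≢ k → fromValues m k v S ≡ false
fromValues-outside zero zero v [] ∣S∣≢k = ⊥-elim (∣S∣≢k refl)
fromValues-outside zero (suc k) v [] ∣S∣≢k = refl
fromValues-outside (suc m) zero v (true ∷ S) ∣S∣≢k = refl
fromValues-outside (suc m) zero v (false ∷ S) ∣S∣≢k = fromValues-outside m zero v S ∣S∣≢k
fromValues-outside (suc m) (suc k) v (true ∷ S) ∣S∣≢k =
  fromValues-outside m k (take (choose m k) v) S (∣S∣≢k ∘ cong suc)
fromValues-outside (suc m) (suc k) v (false ∷ S) ∣S∣≢k =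
  fromValues-outside m (suc k) (drop (choose m k) v) S ∣S∣≢k

-- Linear maps between spaces of integer-valued functions

infixl 6 _+̇_ _-̇_
infix 8 -̇_

0̇ : {A : Set} → A → ℤ
0̇ _ = + 0

-̇_ : {A : Set} → (A → ℤ) → A → ℤ
(-̇ f) x = - f x

_+̇_ _-̇_ : {A : Set} → (A → ℤ) → (A → ℤ) → A → ℤ
(f +̇ g) x = f x + g x
f -̇ g = f +̇ (-̇ g)

record Linear {A B : Set} (L : (A → ℤ) → (B → ℤ)) : Set where
  field
    cong-≗ : ∀ {f g} → f ≗ g → L f ≗ L g
    +-homo : ∀ f g → L (f +̇ g) ≗ L f +̇ L g

  0-homo : L 0̇ ≗ 0̇
  0-homo x = identityˡ-unique (L 0̇ x) (L 0̇ x) (sym (+-homo 0̇ 0̇ x))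

  neg-homo : ∀ f → L (-̇ f) ≗ -̇ L f
  neg-homo f x = inverseˡ-unique (L (-̇ f) x) (L f x) (begin
    L (-̇ f) x + L f x   ≡⟨ +-homo (-̇ f) f x ⟨
    L (-̇ f +̇ f) x       ≡⟨ cong-≗ (+-inverseˡ ∘ f) x ⟩
    L 0̇ x               ≡⟨ 0-homo x ⟩
    + 0                 ∎)
    where open ≡-Reasoning

  sub-homo : ∀ f g → L (f -̇ g) ≗ L f -̇ L g
  sub-homo f g x = trans (+-homo f (-̇ g) x) (cong (λ y → L f x + y) (neg-homo g x))

∘-linear : ∀ {A B C : Set} {L : (B → ℤ) → (C → ℤ)} {M : (A → ℤ) → (B → ℤ)} →
  Linear L → Linear M → Linear (L ∘ M)
∘-linear {L = L} {M} L-linear M-linear = record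
  { cong-≗ = Linear.cong-≗ L-linear ∘ Linear.cong-≗ M-linear
  ; +-homo = λ f g x →
      trans (Linear.cong-≗ L-linear (Linear.+-homo M-linear f g) x) (Linear.+-homo L-linear (M f) (M g) x)
  }

-- Cellular cochains of the torus

pattern a₀ = false , true
pattern b₀ = false , false
pattern a₁ = true , true
pattern b₁ = true , false

δ-linear : ∀ {n} → Linear (δ {n})
δ-linear = record { cong-≗ = δ-cong ; +-homo = δ-+ }
  where
  δ-cong : ∀ {n} {f g : Fn n} → f ≗ g → δ f ≗ δ g
  δ-cong {zero} f≗g [] = refl
  δ-cong {suc n} f≗g ((true , s) ∷ τ) =
    cong₂ _-_ (cong₂ _-_ (f≗g _) (f≗g _)) (δ-cong (f≗g ∘ ((true , s) ∷_)) τ)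
  δ-cong {suc n} f≗g ((false , s) ∷ τ) = δ-cong (f≗g ∘ ((false , s) ∷_)) τ

  δ-+ : ∀ {n} (f g : Fn n) → δ (f +̇ g) ≗ δ f +̇ δ g
  δ-+ {zero} f g [] = refl
  δ-+ {suc n} f g ((true , s) ∷ τ) =
    trans (cong (λ z → (f (target ∷ τ) + g (target ∷ τ) - (f (source ∷ τ) + g (source ∷ τ))) - z)
                (δ-+ (f ∘ ((true , s) ∷_)) (g ∘ ((true , s) ∷_)) τ))
          (regroup (f (target ∷ τ)) (g (target ∷ τ)) (f (source ∷ τ)) (g (source ∷ τ))
                   (δ (f ∘ ((true , s) ∷_)) τ) (δ (g ∘ ((true , s) ∷_)) τ))
    where
    target source : S1Cell
    target = false , not s
    source = false , s
    regroup : ∀ a b c d e h → (a + b - (c + d)) - (e + h) ≡ (a - c - e) + (b - d - h)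
    regroup = solve-∀
  δ-+ {suc n} f g ((false , s) ∷ τ) = δ-+ (f ∘ ((false , s) ∷_)) (g ∘ ((false , s) ∷_)) τ

module δ {n} = Linear (δ-linear {n})

ν-involutive : ∀ {n} (σ : Cell n) → ν· (ν· σ) ≡ σ
ν-involutive [] = refl
ν-involutive ((e , s) ∷ σ) = cong₂ (λ s′ σ′ → (e , s′) ∷ σ′) (not-involutive s) (ν-involutive σ)

dim-ν : ∀ {n} (σ : Cell n) → dim (ν· σ) ≡ dim σ
dim-ν [] = refl
dim-ν ((true , s) ∷ σ) = cong suc (dim-ν σ)
dim-ν ((false , s) ∷ σ) = dim-ν σ

δ-∘ν : ∀ {n} (g : Fn n) → δ (g ∘ ν·) ≗ δ g ∘ ν·
δ-∘ν {zero} g [] = refl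
δ-∘ν {suc n} g ((true , s) ∷ τ) =
  cong (λ z → g ((false , not (not s)) ∷ ν· τ) - g ((false , not s) ∷ ν· τ) - z)
       (δ-∘ν (g ∘ ((true , not s) ∷_)) τ)
δ-∘ν {suc n} g ((false , s) ∷ τ) = δ-∘ν (g ∘ ((false , not s) ∷_)) τ

δ-local : ∀ {n} (g h : Fn n) σ → (∀ ρ → suc (dim ρ) ≡ dim σ → g ρ ≡ h ρ) → δ g σ ≡ δ h σ
δ-local {zero} g h [] agree = refl
δ-local {suc n} g h ((true , s) ∷ τ) agree =
  cong₂ _-_ (cong₂ _-_ (agree _ refl) (agree _ refl))
            (δ-local (g ∘ ((true , s) ∷_)) (h ∘ ((true , s) ∷_)) τ (λ ρ → agree _ ∘ cong suc))
δ-local {suc n} g h ((false , s) ∷ τ) agree =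
  δ-local (g ∘ ((false , s) ∷_)) (h ∘ ((false , s) ∷_)) τ (agree ∘ ((false , s) ∷_))

norm : ∀ {n} → Fn n → Fn n
norm f = f +̇ f ∘ ν·

norm-linear : ∀ {n} → Linear (norm {n})
norm-linear = record
  { cong-≗ = λ f≗g σ → cong₂ _+_ (f≗g σ) (f≗g (ν· σ))
  ; +-homo = λ f g σ → regroup (f σ) (g σ) (f (ν· σ)) (g (ν· σ))
  }
  where
  regroup : ∀ a b c d → (a + b) + (c + d) ≡ (a + c) + (b + d)
  regroup = solve-∀

module norm {n} = Linear (norm-linear {n})

δ-norm : ∀ {n} (g : Fn n) → δ (norm g) ≗ norm (δ g)
δ-norm g σ = trans (δ.+-homo g (g ∘ ν·) σ) (cong (λ z → δ g σ + z) (δ-∘ν g σ))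

Antiequivariant : ∀ {n} → Fn n → Set
Antiequivariant F = ∀ σ → F (ν· σ) ≡ - F σ

δ-antiequivariant : ∀ {n} (G : Fn n) → Antiequivariant G → Antiequivariant (δ G)
δ-antiequivariant G anti σ = trans (sym (δ-∘ν G σ)) (trans (δ.cong-≗ anti σ) (δ.neg-homo G σ))

-- Cohomology of the torus

support : ∀ {n} → Cell n → Subset n
support [] = []
support ((e , _) ∷ σ) = e ∷ support σ

∣support∣ : ∀ {n} (σ : Cell n) → ∣ support σ ∣ ≡ dim σ
∣support∣ [] = refl
∣support∣ ((true , s) ∷ σ) = cong suc (∣support∣ σ)
∣support∣ ((false , s) ∷ σ) = ∣support∣ σ

-- Slant product with the fundamental cycle a₁ + b₁ of the first circle factor.
slant : ∀ {n} → Fn (suc n) → Fn n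
slant f = f ∘ (a₁ ∷_) +̇ f ∘ (b₁ ∷_)

slant-linear : ∀ {n} → Linear (slant {n})
slant-linear = record
  { cong-≗ = λ f≗g τ → cong₂ _+_ (f≗g (a₁ ∷ τ)) (f≗g (b₁ ∷ τ))
  ; +-homo = λ f g τ → regroup (f (a₁ ∷ τ)) (g (a₁ ∷ τ)) (f (b₁ ∷ τ)) (g (b₁ ∷ τ))
  }
  where
  regroup : ∀ a b c d → (a + b) + (c + d) ≡ (a + c) + (b + d)
  regroup = solve-∀

module slant {n} = Linear (slant-linear {n})

slant-δ : ∀ {n} (f : Fn (suc n)) → slant (δ f) ≗ -̇ δ (slant f)
slant-δ f τ = begin
  (f (b₀ ∷ τ) - f (a₀ ∷ τ) - δ (f ∘ (a₁ ∷_)) τ) + (f (a₀ ∷ τ) - f (b₀ ∷ τ) - δ (f ∘ (b₁ ∷_)) τ)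
    ≡⟨ cancel (f (b₀ ∷ τ)) (f (a₀ ∷ τ)) (δ (f ∘ (a₁ ∷_)) τ) (δ (f ∘ (b₁ ∷_)) τ) ⟩
  - (δ (f ∘ (a₁ ∷_)) τ + δ (f ∘ (b₁ ∷_)) τ)
    ≡⟨ cong -_ (δ.+-homo (f ∘ (a₁ ∷_)) (f ∘ (b₁ ∷_)) τ) ⟨
  - δ (slant f) τ ∎
  where
  open ≡-Reasoning
  cancel : ∀ a b c d → (a - b - c) + (b - a - d) ≡ - (c + d)
  cancel = solve-∀

-- ev f S is the value of f on the fundamental cycle of the coordinate subtorus T^S through the
-- vertex a₀ … a₀; rep c is the cocycle with value c S on the cells of support S built from a₁ and
-- 0-cells.
ev : ∀ {n} → Fn n → Subset n → ℤ
ev {zero} f [] = f []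
ev {suc n} f (false ∷ S) = ev (f ∘ (a₀ ∷_)) S
ev {suc n} f (true ∷ S) = ev (slant f) S

rep : ∀ {n} → (Subset n → ℤ) → Fn n
rep {zero} c [] = c []
rep {suc n} c ((false , _) ∷ τ) = rep (c ∘ (false ∷_)) τ
rep {suc n} c (a₁ ∷ τ) = rep (c ∘ (true ∷_)) τ
rep {suc n} c (b₁ ∷ τ) = + 0

-- htpy = h ⊗ id + (rep ∘ ev) ⊗ htpy with the Koszul sign, where h is the homotopy of the circle
-- sending a 1-cochain g to the 0-cochain vanishing at a₀ with value − g b₁ at b₀.
htpy : ∀ {n} → Fn n → Fn n
htpy {zero} f [] = + 0
htpy {suc n} f (a₀ ∷ τ) = htpy (f ∘ (a₀ ∷_)) τ
htpy {suc n} f (b₀ ∷ τ) = htpy (f ∘ (a₀ ∷_)) τ - f (b₁ ∷ τ)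
htpy {suc n} f (a₁ ∷ τ) = - htpy (slant f) τ
htpy {suc n} f (b₁ ∷ τ) = + 0

ev-linear : ∀ {n} → Linear (ev {n})
ev-linear = record { cong-≗ = ev-cong ; +-homo = ev-+ }
  where
  ev-cong : ∀ {n} {f g : Fn n} → f ≗ g → ev f ≗ ev g
  ev-cong {zero} f≗g [] = f≗g []
  ev-cong {suc n} f≗g (false ∷ S) = ev-cong (f≗g ∘ (a₀ ∷_)) S
  ev-cong {suc n} f≗g (true ∷ S) = ev-cong (slant.cong-≗ f≗g) S

  ev-+ : ∀ {n} (f g : Fn n) → ev (f +̇ g) ≗ ev f +̇ ev g
  ev-+ {zero} f g [] = refl
  ev-+ {suc n} f g (false ∷ S) = ev-+ (f ∘ (a₀ ∷_)) (g ∘ (a₀ ∷_)) S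
  ev-+ {suc n} f g (true ∷ S) = trans (ev-cong (slant.+-homo f g) S) (ev-+ (slant f) (slant g) S)

module ev {n} = Linear (ev-linear {n})

rep-linear : ∀ {n} → Linear (rep {n})
rep-linear = record { cong-≗ = rep-cong ; +-homo = rep-+ }
  where
  rep-cong : ∀ {n} {c d : Subset n → ℤ} → c ≗ d → rep c ≗ rep d
  rep-cong {zero} c≗d [] = c≗d []
  rep-cong {suc n} c≗d ((false , _) ∷ τ) = rep-cong (c≗d ∘ (false ∷_)) τ
  rep-cong {suc n} c≗d (a₁ ∷ τ) = rep-cong (c≗d ∘ (true ∷_)) τ
  rep-cong {suc n} c≗d (b₁ ∷ τ) = refl

  rep-+ : ∀ {n} (c d : Subset n → ℤ) → rep (c +̇ d) ≗ rep c +̇ rep d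
  rep-+ {zero} c d [] = refl
  rep-+ {suc n} c d ((false , _) ∷ τ) = rep-+ (c ∘ (false ∷_)) (d ∘ (false ∷_)) τ
  rep-+ {suc n} c d (a₁ ∷ τ) = rep-+ (c ∘ (true ∷_)) (d ∘ (true ∷_)) τ
  rep-+ {suc n} c d (b₁ ∷ τ) = refl

module rep {n} = Linear (rep-linear {n})

htpy-linear : ∀ {n} → Linear (htpy {n})
htpy-linear = record { cong-≗ = htpy-cong ; +-homo = htpy-+ }
  where
  htpy-cong : ∀ {n} {f g : Fn n} → f ≗ g → htpy f ≗ htpy g
  htpy-cong {zero} f≗g [] = refl
  htpy-cong {suc n} f≗g (a₀ ∷ τ) = htpy-cong (f≗g ∘ (a₀ ∷_)) τ
  htpy-cong {suc n} f≗g (b₀ ∷ τ) = cong₂ _-_ (htpy-cong (f≗g ∘ (a₀ ∷_)) τ) (f≗g (b₁ ∷ τ))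
  htpy-cong {suc n} f≗g (a₁ ∷ τ) = cong -_ (htpy-cong (slant.cong-≗ f≗g) τ)
  htpy-cong {suc n} f≗g (b₁ ∷ τ) = refl

  htpy-+ : ∀ {n} (f g : Fn n) → htpy (f +̇ g) ≗ htpy f +̇ htpy g
  htpy-+ {zero} f g [] = refl
  htpy-+ {suc n} f g (a₀ ∷ τ) = htpy-+ (f ∘ (a₀ ∷_)) (g ∘ (a₀ ∷_)) τ
  htpy-+ {suc n} f g (b₀ ∷ τ) =
    trans (cong (λ z → z - (f (b₁ ∷ τ) + g (b₁ ∷ τ))) (htpy-+ (f ∘ (a₀ ∷_)) (g ∘ (a₀ ∷_)) τ))
          (regroup (htpy (f ∘ (a₀ ∷_)) τ) (htpy (g ∘ (a₀ ∷_)) τ) (f (b₁ ∷ τ)) (g (b₁ ∷ τ)))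
    where
    regroup : ∀ a b c d → (a + b) - (c + d) ≡ (a - c) + (b - d)
    regroup = solve-∀
  htpy-+ {suc n} f g (a₁ ∷ τ) =
    trans (cong -_ (trans (htpy-cong (slant.+-homo f g) τ) (htpy-+ (slant f) (slant g) τ)))
          (neg-distrib-+ (htpy (slant f) τ) (htpy (slant g) τ))
  htpy-+ {suc n} f g (b₁ ∷ τ) = refl

module htpy {n} = Linear (htpy-linear {n})

ev-δ : ∀ {n} (f : Fn n) → ev (δ f) ≗ 0̇
ev-δ {zero} f [] = refl
ev-δ {suc n} f (false ∷ S) = ev-δ (f ∘ (a₀ ∷_)) S
ev-δ {suc n} f (true ∷ S) = begin
  ev (slant (δ f)) S      ≡⟨ ev.cong-≗ (slant-δ f) S ⟩
  ev (-̇ δ (slant f)) S    ≡⟨ ev.neg-homo (δ (slant f)) S ⟩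
  - ev (δ (slant f)) S    ≡⟨ cong -_ (ev-δ (slant f) S) ⟩
  + 0                     ∎
  where open ≡-Reasoning

δ-rep : ∀ {n} (c : Subset n → ℤ) → δ (rep c) ≗ 0̇
δ-rep {zero} c [] = refl
δ-rep {suc n} c ((true , s) ∷ τ) = trans (cong (λ z → x - x - z) (δ-slice s)) (cancel x)
  where
  x = rep (c ∘ (false ∷_)) τ
  δ-slice : ∀ s → δ (rep c ∘ ((true , s) ∷_)) τ ≡ + 0
  δ-slice true = δ-rep (c ∘ (true ∷_)) τ
  δ-slice false = δ.0-homo τ
  cancel : ∀ x → x - x - + 0 ≡ + 0
  cancel = solve-∀
δ-rep {suc n} c ((false , _) ∷ τ) = δ-rep (c ∘ (false ∷_)) τ

ev-rep : ∀ {n} (c : Subset n → ℤ) → ev (rep c) ≗ c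
ev-rep {zero} c [] = refl
ev-rep {suc n} c (false ∷ S) = ev-rep (c ∘ (false ∷_)) S
ev-rep {suc n} c (true ∷ S) =
  trans (ev.cong-≗ (+-identityʳ ∘ rep (c ∘ (true ∷_))) S) (ev-rep (c ∘ (true ∷_)) S)

ev-rep∘ν : ∀ {n} (c : Subset n → ℤ) → ev (rep c ∘ ν·) ≗ c
ev-rep∘ν {zero} c [] = refl
ev-rep∘ν {suc n} c (false ∷ S) = ev-rep∘ν (c ∘ (false ∷_)) S
ev-rep∘ν {suc n} c (true ∷ S) =
  trans (ev.cong-≗ (+-identityˡ ∘ rep (c ∘ (true ∷_)) ∘ ν·) S) (ev-rep∘ν (c ∘ (true ∷_)) S)

rep-outside : ∀ {n} (c : Subset n → ℤ) σ → c (support σ) ≡ + 0 → rep c σ ≡ + 0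
rep-outside {zero} c [] c≡0 = c≡0
rep-outside {suc n} c ((false , _) ∷ τ) c≡0 = rep-outside (c ∘ (false ∷_)) τ c≡0
rep-outside {suc n} c (a₁ ∷ τ) c≡0 = rep-outside (c ∘ (true ∷_)) τ c≡0
rep-outside {suc n} c (b₁ ∷ τ) c≡0 = refl

htpy-formula : ∀ {n} (f : Fn n) → f ≗ δ (htpy f) +̇ htpy (δ f) +̇ rep (ev f)
htpy-formula {zero} f [] = sym (+-identityˡ (f []))
htpy-formula {suc n} f (a₀ ∷ τ) = htpy-formula (f ∘ (a₀ ∷_)) τ
htpy-formula {suc n} f (b₀ ∷ τ) = sym (begin
  δ (htpy F₀ -̇ F₁) τ + (Y - (f (a₀ ∷ τ) - f (b₀ ∷ τ) - W)) + Z
    ≡⟨ cong (λ z → z + (Y - (f (a₀ ∷ τ) - f (b₀ ∷ τ) - W)) + Z) (δ.sub-homo (htpy F₀) F₁ τ) ⟩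
  (X - W) + (Y - (f (a₀ ∷ τ) - f (b₀ ∷ τ) - W)) + Z
    ≡⟨ cancel (f (a₀ ∷ τ)) (f (b₀ ∷ τ)) X Y Z W (htpy-formula F₀ τ) ⟩
  f (b₀ ∷ τ) ∎)
  where
  open ≡-Reasoning
  F₀ F₁ : Fn n
  F₀ = f ∘ (a₀ ∷_)
  F₁ = f ∘ (b₁ ∷_)
  X = δ (htpy F₀) τ
  Y = htpy (δ F₀) τ
  Z = rep (ev F₀) τ
  W = δ F₁ τ
  cancel : ∀ a b X Y Z W → a ≡ X + Y + Z → (X - W) + (Y - (a - b - W)) + Z ≡ b
  cancel _ b X Y Z W refl = simplify b X Y Z W
    where
    simplify : ∀ b X Y Z W → (X - W) + (Y - (X + Y + Z - b - W)) + Z ≡ b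
    simplify = solve-∀
htpy-formula {suc n} f (a₁ ∷ τ) = sym (begin
  (H - f (b₁ ∷ τ) - H - δ (-̇ htpy (slant f)) τ) + - htpy (slant (δ f)) τ + Z
    ≡⟨ cong₂ (λ u v → (H - f (b₁ ∷ τ) - H - u) + - v + Z) (δ.neg-homo (htpy (slant f)) τ) slant-part ⟩
  (H - f (b₁ ∷ τ) - H - - X) + - - Y + Z
    ≡⟨ simplify (f (b₁ ∷ τ)) H X Y Z ⟩
  (X + Y + Z) - f (b₁ ∷ τ)
    ≡⟨ cong (λ z → z - f (b₁ ∷ τ)) (htpy-formula (slant f) τ) ⟨
  f (a₁ ∷ τ) + f (b₁ ∷ τ) - f (b₁ ∷ τ)
    ≡⟨ cancel (f (a₁ ∷ τ)) (f (b₁ ∷ τ)) ⟩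
  f (a₁ ∷ τ) ∎)
  where
  open ≡-Reasoning
  H = htpy (f ∘ (a₀ ∷_)) τ
  X = δ (htpy (slant f)) τ
  Y = htpy (δ (slant f)) τ
  Z = rep (ev (slant f)) τ
  slant-part : htpy (slant (δ f)) τ ≡ - Y
  slant-part = trans (htpy.cong-≗ (slant-δ f) τ) (htpy.neg-homo (δ (slant f)) τ)
  simplify : ∀ b H X Y Z → (H - b - H - - X) + - - Y + Z ≡ (X + Y + Z) - b
  simplify = solve-∀
  cancel : ∀ a b → a + b - b ≡ a
  cancel = solve-∀
htpy-formula {suc n} f (b₁ ∷ τ) = sym (begin
  (H - (H - f (b₁ ∷ τ)) - δ 0̇ τ) + + 0 + + 0
    ≡⟨ cong (λ z → (H - (H - f (b₁ ∷ τ)) - z) + + 0 + + 0) (δ.0-homo τ) ⟩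
  (H - (H - f (b₁ ∷ τ)) - + 0) + + 0 + + 0
    ≡⟨ cancel H (f (b₁ ∷ τ)) ⟩
  f (b₁ ∷ τ) ∎)
  where
  open ≡-Reasoning
  H = htpy (f ∘ (a₀ ∷_)) τ
  cancel : ∀ H b → (H - (H - b) - + 0) + + 0 + + 0 ≡ b
  cancel = solve-∀

δ-htpy-cocycle : ∀ {n} (g : Fn n) → δ g ≗ 0̇ → δ (htpy g) ≗ g -̇ rep (ev g)
δ-htpy-cocycle g δg≗0 τ = begin
  δ (htpy g) τ
    ≡⟨ solve-for-first (δ (htpy g) τ) (htpy (δ g) τ) (rep (ev g) τ) (g τ) (htpy-formula g τ) ⟩
  g τ - htpy (δ g) τ - rep (ev g) τ
    ≡⟨ cong (λ z → g τ - z - rep (ev g) τ) (trans (htpy.cong-≗ δg≗0 τ) (htpy.0-homo τ)) ⟩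
  g τ - + 0 - rep (ev g) τ
    ≡⟨ cong (λ z → z - rep (ev g) τ) (+-identityʳ (g τ)) ⟩
  g τ - rep (ev g) τ ∎
  where
  open ≡-Reasoning
  solve-for-first : ∀ x y z w → w ≡ x + y + z → x ≡ w - y - z
  solve-for-first x y z _ refl = rearrange x y z
    where
    rearrange : ∀ x y z → x ≡ x + y + z - y - z
    rearrange = solve-∀

htpy-δ : ∀ {n} (f : Fn n) → htpy (δ f) ≗ f -̇ δ (htpy f) -̇ rep (ev f)
htpy-δ f τ = solve-for-second (δ (htpy f) τ) (htpy (δ f) τ) (rep (ev f) τ) (f τ) (htpy-formula f τ)
  where
  solve-for-second : ∀ x y z w → w ≡ x + y + z → y ≡ w - x - z
  solve-for-second x y z _ refl = rearrange x y z
    where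
    rearrange : ∀ x y z → y ≡ x + y + z - x - z
    rearrange = solve-∀

module ev∘norm {n} = Linear (∘-linear (ev-linear {n}) norm-linear)

ev-norm-δ : ∀ {n} (g : Fn n) → ev (norm (δ g)) ≗ 0̇
ev-norm-δ g S = trans (ev.cong-≗ (sym ∘ δ-norm g) S) (ev-δ (norm g) S)

ev-norm-rep : ∀ {n} (c : Subset n → ℤ) → ev (norm (rep c)) ≗ c +̇ c
ev-norm-rep c S = trans (ev.+-homo (rep c) (rep c ∘ ν·) S) (cong₂ _+_ (ev-rep c S) (ev-rep∘ν c S))

-- Equivariant cochains as a mapping cone

glue : ∀ {m} → Fn m → Fn m → Fn (suc m)
glue X Y (a₀ ∷ τ) = X τ
glue X Y (b₀ ∷ τ) = - X (ν· τ)
glue X Y (a₁ ∷ τ) = Y τ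
glue X Y (b₁ ∷ τ) = - Y (ν· τ)

glue-antiequivariant : ∀ {m} (X Y : Fn m) → Antiequivariant (glue X Y)
glue-antiequivariant X Y (a₀ ∷ τ) = cong (-_ ∘ X) (ν-involutive τ)
glue-antiequivariant X Y (b₀ ∷ τ) = sym (neg-involutive (X (ν· τ)))
glue-antiequivariant X Y (a₁ ∷ τ) = cong (-_ ∘ Y) (ν-involutive τ)
glue-antiequivariant X Y (b₁ ∷ τ) = sym (neg-involutive (Y (ν· τ)))

antiequivariant-flip : ∀ {n} {f : Fn (suc n)} → Antiequivariant f →
  ∀ e τ → f ((e , false) ∷ τ) ≡ - f ((e , true) ∷ ν· τ)
antiequivariant-flip {f = f} anti e τ =
  trans (cong (λ ρ → f ((e , false) ∷ ρ)) (sym (ν-involutive τ))) (anti ((e , true) ∷ ν· τ))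

antiequivariant-unique : ∀ {n} (P : Cell (suc n) → Set) → (∀ σ → P σ → P (ν· σ)) →
  {F G : Fn (suc n)} → Antiequivariant F → Antiequivariant G →
  (∀ e τ → P ((e , true) ∷ τ) → F ((e , true) ∷ τ) ≡ G ((e , true) ∷ τ)) →
  ∀ σ → P σ → F σ ≡ G σ
antiequivariant-unique P P-ν F-anti G-anti agree ((e , true) ∷ τ) p = agree e τ p
antiequivariant-unique P P-ν {F} {G} F-anti G-anti agree ((e , false) ∷ τ) p = begin
  F ((e , false) ∷ τ)       ≡⟨ antiequivariant-flip F-anti e τ ⟩
  - F ((e , true) ∷ ν· τ)   ≡⟨ cong -_ (agree e (ν· τ) (P-ν _ p)) ⟩
  - G ((e , true) ∷ ν· τ)   ≡⟨ antiequivariant-flip G-anti e τ ⟨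
  G ((e , false) ∷ τ)       ∎
  where open ≡-Reasoning

coneδ : ∀ {m} → Fn m → Fn m → Fn m
coneδ X Y = -̇ norm X -̇ δ Y

δ-a₁ : ∀ {m} (f : Fn (suc m)) → Antiequivariant f →
  δ f ∘ (a₁ ∷_) ≗ coneδ (f ∘ (a₀ ∷_)) (f ∘ (a₁ ∷_))
δ-a₁ f anti τ =
  trans (cong (λ z → z - f (a₀ ∷ τ) - δ (f ∘ (a₁ ∷_)) τ) (antiequivariant-flip anti false τ))
        (regroup (f (a₀ ∷ ν· τ)) (f (a₀ ∷ τ)) (δ (f ∘ (a₁ ∷_)) τ))
  where
  regroup : ∀ x′ x d → - x′ - x - d ≡ - (x + x′) - d
  regroup = solve-∀

module norm∘htpy {n} = Linear (∘-linear (norm-linear {n}) htpy-linear)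

-- For a cone cocycle (A , B), B + norm (htpy A) is a cocycle of T^m and this is its class.
invariant : ∀ {m} → Fn m → Fn m → Subset m → ℤ
invariant A B = ev (B +̇ norm (htpy A))

invariant-cong : ∀ {m} {A A′ B B′ : Fn m} → A ≗ A′ → B ≗ B′ → invariant A B ≗ invariant A′ B′
invariant-cong A≗A′ B≗B′ = ev.cong-≗ (λ τ → cong₂ _+_ (B≗B′ τ) (norm∘htpy.cong-≗ A≗A′ τ))

invariant-+ : ∀ {m} (A A′ B B′ : Fn m) →
  invariant (A +̇ A′) (B +̇ B′) ≗ invariant A B +̇ invariant A′ B′
invariant-+ A A′ B B′ S =
  trans (ev.cong-≗ split S) (ev.+-homo (B +̇ norm (htpy A)) (B′ +̇ norm (htpy A′)) S)
  where
  regroup : ∀ a b c d → (a + b) + (c + d) ≡ (a + c) + (b + d)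
  regroup = solve-∀
  split : B +̇ B′ +̇ norm (htpy (A +̇ A′)) ≗ (B +̇ norm (htpy A)) +̇ (B′ +̇ norm (htpy A′))
  split τ = trans (cong (λ z → B τ + B′ τ + z) (norm∘htpy.+-homo A A′ τ))
                  (regroup (B τ) (B′ τ) (norm (htpy A) τ) (norm (htpy A′) τ))

invariant-coboundary : ∀ {m} (X Y : Fn m) → invariant (δ X) (coneδ X Y) ≗ -̇ (ev X +̇ ev X)
invariant-coboundary X Y S = begin
  ev (coneδ X Y +̇ norm (htpy (δ X))) S         ≡⟨ ev.+-homo (coneδ X Y) (norm (htpy (δ X))) S ⟩
  ev (coneδ X Y) S + ev (norm (htpy (δ X))) S   ≡⟨ cong₂ _+_ cone-part htpy-part ⟩
  (- N - + 0) + (N - + 0 - (E + E))             ≡⟨ cancel N E ⟩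
  - (E + E)                                     ∎
  where
  open ≡-Reasoning
  N = ev (norm X) S
  E = ev X S
  cone-part : ev (coneδ X Y) S ≡ - N - + 0
  cone-part = trans (ev.sub-homo (-̇ norm X) (δ Y) S) (cong₂ _-_ (ev.neg-homo (norm X) S) (ev-δ Y S))
  htpy-part : ev (norm (htpy (δ X))) S ≡ N - + 0 - (E + E)
  htpy-part = begin
    ev (norm (htpy (δ X))) S
      ≡⟨ ev∘norm.cong-≗ (htpy-δ X) S ⟩
    ev (norm (X -̇ δ (htpy X) -̇ rep (ev X))) S
      ≡⟨ ev∘norm.sub-homo (X -̇ δ (htpy X)) (rep (ev X)) S ⟩
    ev (norm (X -̇ δ (htpy X))) S - ev (norm (rep (ev X))) S
      ≡⟨ cong₂ _-_ (ev∘norm.sub-homo X (δ (htpy X)) S) (ev-norm-rep (ev X) S) ⟩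
    N - ev (norm (δ (htpy X))) S - (E + E)
      ≡⟨ cong (λ z → N - z - (E + E)) (ev-norm-δ (htpy X) S) ⟩
    N - + 0 - (E + E) ∎
  cancel : ∀ N E → (- N - + 0) + (N - + 0 - (E + E)) ≡ - (E + E)
  cancel = solve-∀

double≡0⇒≡0 : ∀ x → - (x + x) ≡ + 0 → x ≡ + 0
double≡0⇒≡0 (+ zero) _ = refl
double≡0⇒≡0 (+ suc n) ()
double≡0⇒≡0 -[1+ n ] ()

module ConeCocycle {m} (A B : Fn m) (δA≗0 : δ A ≗ 0̇) (coneδ≗0 : coneδ A B ≗ 0̇) where

  norm-A : norm A ≗ -̇ δ B
  norm-A τ = solve-for-first (norm A τ) (δ B τ) (coneδ≗0 τ)
    where
    solve-for-first : ∀ a b → - a - b ≡ + 0 → a ≡ - b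
    solve-for-first a b eq = begin
      a                 ≡⟨ rearrange a b ⟩
      - (- a - b) - b   ≡⟨ cong (λ z → - z - b) eq ⟩
      + 0 - b           ≡⟨ +-identityˡ (- b) ⟩
      - b               ∎
      where
      open ≡-Reasoning
      rearrange : ∀ a b → a ≡ - (- a - b) - b
      rearrange = solve-∀

  ev-A≗0 : ev A ≗ 0̇
  ev-A≗0 S = double≡0⇒≡0 (ev A S) (begin
    - (ev A S + ev A S)                        ≡⟨ +-identityˡ _ ⟨
    + 0 - (ev A S + ev A S)                    ≡⟨ cong₂ _-_ ev-norm-A (ev-norm-rep (ev A) S) ⟨
    ev (norm A) S - ev (norm (rep (ev A))) S   ≡⟨ ev∘norm.sub-homo A (rep (ev A)) S ⟨
    ev (norm (A -̇ rep (ev A))) S               ≡⟨ ev∘norm.cong-≗ (δ-htpy-cocycle A δA≗0) S ⟨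
    ev (norm (δ (htpy A))) S                   ≡⟨ ev-norm-δ (htpy A) S ⟩
    + 0                                        ∎)
    where
    open ≡-Reasoning
    ev-norm-A : ev (norm A) S ≡ + 0
    ev-norm-A = trans (ev.cong-≗ norm-A S) (trans (ev.neg-homo (δ B) S) (cong -_ (ev-δ B S)))

  δ-htpy-A : δ (htpy A) ≗ A
  δ-htpy-A τ = begin
    δ (htpy A) τ          ≡⟨ δ-htpy-cocycle A δA≗0 τ ⟩
    A τ - rep (ev A) τ    ≡⟨ cong (λ z → A τ - z) (trans (rep.cong-≗ ev-A≗0 τ) (rep.0-homo τ)) ⟩
    A τ - + 0             ≡⟨ +-identityʳ (A τ) ⟩
    A τ                   ∎
    where open ≡-Reasoning

  B̂ : Fn m
  B̂ = B +̇ norm (htpy A)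

  δB̂≗0 : δ B̂ ≗ 0̇
  δB̂≗0 τ = begin
    δ B̂ τ                          ≡⟨ δ.+-homo B (norm (htpy A)) τ ⟩
    δ B τ + δ (norm (htpy A)) τ    ≡⟨ cong (λ z → δ B τ + z) (δ-norm (htpy A) τ) ⟩
    δ B τ + norm (δ (htpy A)) τ    ≡⟨ cong (λ z → δ B τ + z) (norm.cong-≗ δ-htpy-A τ) ⟩
    δ B τ + norm A τ               ≡⟨ cong (λ z → δ B τ + z) (norm-A τ) ⟩
    δ B τ - δ B τ                  ≡⟨ +-inverseʳ (δ B τ) ⟩
    + 0                            ∎
    where open ≡-Reasoning

  module Primitive (e r : Subset m → ℤ) (split : invariant A B ≗ (e +̇ e) +̇ r) where

    -- Cone coboundaries change B by norms, and norm (rep e) differs from 2 · rep e by the coboundary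
    -- δ (htpy (rep e ∘ ν)) since ν acts trivially on cohomology; this absorbs the even part of B̂.
    X Y : Fn m
    X = htpy A -̇ rep e
    Y = htpy (rep e ∘ ν·) -̇ htpy B̂

    δX≗A : δ X ≗ A
    δX≗A τ = begin
      δ X τ                          ≡⟨ δ.sub-homo (htpy A) (rep e) τ ⟩
      δ (htpy A) τ - δ (rep e) τ     ≡⟨ cong₂ _-_ (δ-htpy-A τ) (δ-rep e τ) ⟩
      A τ - + 0                      ≡⟨ +-identityʳ (A τ) ⟩
      A τ                            ∎
      where open ≡-Reasoning

    coneδ-X-Y : coneδ X Y ≗ B -̇ rep r
    coneδ-X-Y τ = begin
      coneδ X Y τ
        ≡⟨ cong (λ z → - norm X τ - z) (δ.sub-homo (htpy (rep e ∘ ν·)) (htpy B̂) τ) ⟩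
      - norm X τ - (δ (htpy (rep e ∘ ν·)) τ - δ (htpy B̂) τ)
        ≡⟨ cong₂ (λ u v → - norm X τ - (u - v)) twisted-part B̂-part ⟩
      - norm X τ - ((u′ - u) - (B̂ τ - ((u + u) + s)))
        ≡⟨ cancel (B τ) (htpy A τ) (htpy A (ν· τ)) u u′ s ⟩
      B τ - s ∎
      where
      open ≡-Reasoning
      u = rep e τ
      u′ = rep e (ν· τ)
      s = rep r τ
      twisted-part : δ (htpy (rep e ∘ ν·)) τ ≡ u′ - u
      twisted-part = trans (δ-htpy-cocycle (rep e ∘ ν·) (λ σ → trans (δ-∘ν (rep e) σ) (δ-rep e (ν· σ))) τ)
                           (cong (λ z → u′ - z) (rep.cong-≗ (ev-rep∘ν e) τ))
      B̂-part : δ (htpy B̂) τ ≡ B̂ τ - ((u + u) + s)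
      B̂-part = trans (δ-htpy-cocycle B̂ δB̂≗0 τ) (cong (λ z → B̂ τ - z) (begin
        rep (ev B̂) τ              ≡⟨ rep.cong-≗ split τ ⟩
        rep ((e +̇ e) +̇ r) τ       ≡⟨ rep.+-homo (e +̇ e) r τ ⟩
        rep (e +̇ e) τ + s         ≡⟨ cong (λ z → z + s) (rep.+-homo e e τ) ⟩
        (u + u) + s               ∎))
      cancel : ∀ b h h′ u u′ s →
        - ((h - u) + (h′ - u′)) - ((u′ - u) - ((b + (h + h′)) - ((u + u) + s))) ≡ b - s
      cancel = solve-∀

-- The primitives built from htpy live in all degrees; only their degree-k part matters.
truncate : ∀ {n} → ℕ → Fn n → Fn n
truncate k G σ with dim σ ℕ.≟ k
... | yes _ = G σ
... | no _ = + 0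

truncate-on : ∀ {n} k (G : Fn n) σ → dim σ ≡ k → truncate k G σ ≡ G σ
truncate-on k G σ dσ≡k with dim σ ℕ.≟ k
... | yes _ = refl
... | no dσ≢k = ⊥-elim (dσ≢k dσ≡k)

truncate-off : ∀ {n} k (G : Fn n) σ → dim σ ≢ k → truncate k G σ ≡ + 0
truncate-off k G σ dσ≢k with dim σ ℕ.≟ k
... | yes dσ≡k = ⊥-elim (dσ≢k dσ≡k)
... | no _ = refl

truncate-antiequivariant : ∀ {n} k (G : Fn n) → Antiequivariant G → Antiequivariant (truncate k G)
truncate-antiequivariant k G anti σ with dim σ ℕ.≟ k
... | yes dσ≡k = trans (truncate-on k G (ν· σ) (trans (dim-ν σ) dσ≡k)) (anti σ)
... | no dσ≢k = truncate-off k G (ν· σ) (dσ≢k ∘ trans (sym (dim-ν σ)))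

δ-truncate : ∀ {n} k (G f : Fn n) → (∀ σ → dim σ ≢ suc k → f σ ≡ + 0) →
  (∀ σ → dim σ ≡ suc k → δ G σ ≡ f σ) → δ (truncate k G) ≗ f
δ-truncate k G f f-supp δG≡f σ with dim σ ℕ.≟ suc k
... | yes dσ≡1+k = trans (δ-local (truncate k G) G σ on) (δG≡f σ dσ≡1+k)
  where
  on : ∀ ρ → suc (dim ρ) ≡ dim σ → truncate k G ρ ≡ G ρ
  on ρ dσ≡1+dρ = truncate-on k G ρ (suc-injective (trans dσ≡1+dρ dσ≡1+k))
... | no dσ≢1+k = trans (δ-local (truncate k G) 0̇ σ off) (trans (δ.0-homo σ) (sym (f-supp σ dσ≢1+k)))
  where
  off : ∀ ρ → suc (dim ρ) ≡ dim σ → truncate k G ρ ≡ + 0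
  off ρ dσ≡1+dρ = truncate-off k G ρ (λ dρ≡k → dσ≢1+k (trans (sym dσ≡1+dρ) (cong suc dρ≡k)))

class₂ : ∀ {m} → Fn (suc m) → Subset m → Bool
class₂ f S = parity (invariant (f ∘ (a₀ ∷_)) (f ∘ (a₁ ∷_)) S)

class₂-cong : ∀ {m} {f g : Fn (suc m)} → f ≗ g → class₂ f ≗ class₂ g
class₂-cong f≗g = cong parity ∘ invariant-cong (f≗g ∘ (a₀ ∷_)) (f≗g ∘ (a₁ ∷_))

class₂-+ : ∀ {m} (f g : Fn (suc m)) → ∀ S → class₂ (f +̇ g) S ≡ class₂ f S xor class₂ g S
class₂-+ f g S = trans (cong parity (invariant-+ F₀ G₀ F₁ G₁ S)) (parity-+ (invariant F₀ F₁ S) (invariant G₀ G₁ S))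
  where
  F₀ F₁ G₀ G₁ : Fn _
  F₀ = f ∘ (a₀ ∷_)
  F₁ = f ∘ (a₁ ∷_)
  G₀ = g ∘ (a₀ ∷_)
  G₁ = g ∘ (a₁ ∷_)

coboundary⇒class₂≡false : ∀ {m} k (f : Fn (suc m)) → IsCoboundary (suc k) f → ∀ S → class₂ f S ≡ false
coboundary⇒class₂≡false k f (g , (_ , g-anti) , δg≗f) S = begin
  class₂ f S
    ≡⟨ cong parity (invariant-cong (sym ∘ δg≗f ∘ (a₀ ∷_)) f₁≗coneδ S) ⟩
  parity (invariant (δ G₀) (coneδ G₀ G₁) S)
    ≡⟨ cong parity (invariant-coboundary G₀ G₁ S) ⟩
  parity (- (ev G₀ S + ev G₀ S))
    ≡⟨ parity-neg (ev G₀ S + ev G₀ S) ⟩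
  parity (ev G₀ S + ev G₀ S)
    ≡⟨ parity-double (ev G₀ S) ⟩
  false ∎
  where
  open ≡-Reasoning
  G₀ G₁ : Fn _
  G₀ = g ∘ (a₀ ∷_)
  G₁ = g ∘ (a₁ ∷_)
  f₁≗coneδ : f ∘ (a₁ ∷_) ≗ coneδ G₀ G₁
  f₁≗coneδ τ = trans (sym (δg≗f (a₁ ∷ τ))) (δ-a₁ g g-anti τ)

class₂≡false⇒coboundary : ∀ {m} k (f : Fn (suc m)) → IsCocycle (suc k) f →
  (∀ S → ∣ S ∣ ≡ k → class₂ f S ≡ false) → IsCoboundary (suc k) f
class₂≡false⇒coboundary {m} k f ((f-supp , f-anti) , δf≗0) even =
  truncate k G , (truncate-off k G , truncate-antiequivariant k G G-anti) , δ-truncate k G f f-supp δG≡f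
  where
  A B : Fn m
  A = f ∘ (a₀ ∷_)
  B = f ∘ (a₁ ∷_)
  open ConeCocycle A B (δf≗0 ∘ (a₀ ∷_)) (λ τ → trans (sym (δ-a₁ f f-anti τ)) (δf≗0 (a₁ ∷ τ)))
  half remainder : Subset m → ℤ
  half S = proj₁ (parity-decomposition (invariant A B S))
  remainder S = bit (parity (invariant A B S))
  open Primitive half remainder (proj₂ ∘ parity-decomposition ∘ invariant A B)
  G : Fn (suc m)
  G = glue X Y
  G-anti : Antiequivariant G
  G-anti = glue-antiequivariant X Y
  agree : ∀ x τ → dim ((x , true) ∷ τ) ≡ suc k → δ G ((x , true) ∷ τ) ≡ f ((x , true) ∷ τ)
  agree false τ _ = δX≗A τ
  agree true τ d≡1+k = begin
    δ G (a₁ ∷ τ)            ≡⟨ δ-a₁ G G-anti τ ⟩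
    coneδ X Y τ             ≡⟨ coneδ-X-Y τ ⟩
    B τ - rep remainder τ   ≡⟨ cong (λ z → B τ - z) (rep-outside remainder τ (cong bit remainder-even)) ⟩
    B τ - + 0               ≡⟨ +-identityʳ (B τ) ⟩
    B τ                     ∎
    where
    open ≡-Reasoning
    remainder-even = even (support τ) (trans (∣support∣ τ) (suc-injective d≡1+k))
  δG≡f : ∀ σ → dim σ ≡ suc k → δ G σ ≡ f σ
  δG≡f = antiequivariant-unique (λ σ → dim σ ≡ suc k) (λ σ → trans (dim-ν σ))
                                (δ-antiequivariant G G-anti) f-anti agree

cocycle-with-class₂ : ∀ {m} k (c : Subset m → Bool) → (∀ S → ∣ S ∣ ≢ k → c S ≡ false) →
  ∃[ f ] IsCocycle (suc k) f × class₂ f ≗ c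
cocycle-with-class₂ {m} k c c-supp = f , ((f-supp , f-anti) , δf≗0) , class₂≗c
  where
  f : Fn (suc m)
  f = glue 0̇ (rep (bit ∘ c))
  f-anti : Antiequivariant f
  f-anti = glue-antiequivariant 0̇ (rep (bit ∘ c))
  rep-outside-k : ∀ τ → dim τ ≢ k → rep (bit ∘ c) τ ≡ + 0
  rep-outside-k τ dτ≢k =
    rep-outside (bit ∘ c) τ (cong bit (c-supp (support τ) (dτ≢k ∘ trans (sym (∣support∣ τ)))))
  f-supp : ∀ σ → dim σ ≢ suc k → f σ ≡ + 0
  f-supp (a₀ ∷ τ) _ = refl
  f-supp (b₀ ∷ τ) _ = refl
  f-supp (a₁ ∷ τ) dσ≢1+k = rep-outside-k τ (dσ≢1+k ∘ cong suc)
  f-supp (b₁ ∷ τ) dσ≢1+k = cong -_ (rep-outside-k (ν· τ) (dσ≢1+k ∘ cong suc ∘ trans (sym (dim-ν τ))))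
  agree : ∀ x τ → ⊤ → δ f ((x , true) ∷ τ) ≡ + 0
  agree false τ _ = δ.0-homo τ
  agree true τ _ = trans (δ-a₁ f f-anti τ) (cong (λ z → - norm 0̇ τ - z) (δ-rep (bit ∘ c) τ))
  δf≗0 : δ f ≗ 0̇
  δf≗0 σ = antiequivariant-unique (λ _ → ⊤) _ (δ-antiequivariant f f-anti) (λ _ → refl) agree σ tt
  class₂≗c : class₂ f ≗ c
  class₂≗c S = begin
    parity (ev (rep (bit ∘ c) +̇ norm (htpy 0̇)) S)
      ≡⟨ cong parity (ev.cong-≗ drop-norm S) ⟩
    parity (ev (rep (bit ∘ c)) S)
      ≡⟨ cong parity (ev-rep (bit ∘ c) S) ⟩
    parity (bit (c S))
      ≡⟨ parity-bit (c S) ⟩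
    c S ∎
    where
    open ≡-Reasoning
    drop-norm : rep (bit ∘ c) +̇ norm (htpy 0̇) ≗ rep (bit ∘ c)
    drop-norm τ = trans (cong (λ z → rep (bit ∘ c) τ + z) (norm∘htpy.0-homo τ)) (+-identityʳ _)

bredonIso : ∀ m k → BredonIso (suc m) (suc k) (choose m k)
bredonIso m k = φ , (λ f g _ _ → values-cong m k ∘ class₂-cong)
              , (λ f g _ _ → trans (values-cong m k (class₂-+ f g)) (values-xor m k (class₂ f) (class₂ g)))
              , surjective , (λ f f-cocycle → mk⇔ (kernel⇒coboundary f f-cocycle) (coboundary⇒kernel f))
  where
  φ : Fn (suc m) → Vec Bool (choose m k)
  φ f = values m k (class₂ f)
  surjective : ∀ v → ∃[ f ] IsCocycle (suc k) f × φ f ≡ v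
  surjective v with cocycle-with-class₂ k (fromValues m k v) (fromValues-outside m k v)
  ... | f , f-cocycle , class₂≗ = f , f-cocycle , trans (values-cong m k class₂≗) (values-fromValues m k v)
  kernel⇒coboundary : ∀ f → IsCocycle (suc k) f → φ f ≡ replicate (choose m k) false →
    IsCoboundary (suc k) f
  kernel⇒coboundary f f-cocycle φf≡0 =
    class₂≡false⇒coboundary k f f-cocycle (values≡false⇒ m k (class₂ f) φf≡0)
  coboundary⇒kernel : ∀ f → IsCoboundary (suc k) f → φ f ≡ replicate (choose m k) false
  coboundary⇒kernel f f-coboundary =
    trans (values-cong m k (coboundary⇒class₂≡false k f f-coboundary)) (values-false m k)

propositionB4 : (n d : ℕ) → 1 ≤ n → 1 ≤ d → BredonIso n d ((n ∸ 1) C (d ∸ 1))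
propositionB4 (suc m) (suc k) _ _ = subst (BredonIso (suc m) (suc k)) (choose≡C m k) (bredonIso m k)
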